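{- Consider the $(P_4,P_\ell)$-online Ramsey game, and suppose that at some point of the game (after finitely many rounds) the current colored graph contains a blue path on $k$ vertices. Then Builder has a strategy such that, whatever Painter does, within the next six rounds the colored graph contains either a blue path on $k+4$ vertices or a red path on $4$ vertices.
   Context: $P_n$ denotes a path on $n$ vertices. For graphs $G_1,G_2$, the $(G_1,G_2)$-online Ramsey game is played by Builder and Painter on an infinite set of vertices, initially with no edges. In each round Builder draws one edge between two currently nonadjacent vertices, and Painter immediately colors it red or blue. Builder's goal is to create a red copy of $G_1$ or a blue copy of $G_2$. Since only finitely many edges have been drawn at any point, infinitely many vertices are still isolated. -}

module Defs where

open import Data.Nat using (ℕ; suc; _≤_)
open import Data.Product using (_×_; _,_; ∃)
open import Data.Sum using (_⊎_)
open import Data.List using (List; []; _∷_; length)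
open import Data.List.Relation.Unary.Any using (Any)
open import Data.List.Relation.Unary.Linked using (Linked)
open import Data.List.Relation.Unary.Unique.Propositional using (Unique)
open import Data.List.Membership.Propositional using (_∈_)
open import Relation.Binary.PropositionalEquality using (_≡_; _≢_)
open import Relation.Nullary using (¬_)

data Colour : Set where
  red blue : Colour

-- The vertex set is ℕ (infinite).  A coloured graph is the finite list of
-- the edges drawn so far, each an (endpoint, endpoint, colour) triple.
ColouredGraph : Set
ColouredGraph = List (ℕ × ℕ × Colour)

Adjacent : ColouredGraph → ℕ → ℕ → Set
Adjacent G u v = Any (λ { (a , b , _) → (a ≡ u × b ≡ v) ⊎ (a ≡ v × b ≡ u) }) G

ColEdge : ColouredGraph → Colour → ℕ → ℕ → Set
ColEdge G c u v = ((u , v , c) ∈ G) ⊎ ((v , u , c) ∈ G)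

-- A legal game position: a simple graph (no loops, no repeated edges),
-- as produced by Builder always joining two distinct non-adjacent vertices.
data Simple : ColouredGraph → Set where
  []  : Simple []
  _∷_ : ∀ {G u v c} → (u ≢ v × ¬ Adjacent G u v) → Simple G → Simple ((u , v , c) ∷ G)

HasPath : ColouredGraph → Colour → ℕ → Set
HasPath G c n = ∃ λ (vs : List ℕ) → length vs ≡ n × Unique vs × Linked (ColEdge G c) vs

data BuilderForces (Goal : ColouredGraph → Set) : ℕ → ColouredGraph → Set where
  done : ∀ {r G} → Goal G → BuilderForces Goal r G
  move : ∀ {r G} (u v : ℕ) → u ≢ v → ¬ Adjacent G u v →
         ((c : Colour) → BuilderForces Goal r ((u , v , c) ∷ G)) →
         BuilderForces Goal (suc r) G

-- Builder only ever draws edges with at least one endpoint outside the current graph G, so no such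
-- edge is already present and the play can be described by a
-- small local game on ℕ that is relabelled into G afterwards.  If k = 1, all local vertices are new
-- and Builder forces a blue P₅ or a red P₄ from scratch.  If k ≥ 2, local vertices 0 and 1 stand for
-- the two ends x and y of the blue path and the others are new; within six rounds Builder forces a
-- red P₄ or blue paths P·x and y·Q on new vertices with |P| + |Q| = 4, which extend the blue path by
-- four vertices.  Both local game trees are finite and checked move by move with decision
-- procedures.

module Submission where

open import Data.Nat using (ℕ; suc; _≤_; _<_; _+_; _⊔_; _≤?_; s≤s)
open import Data.Nat.Properties
  using (_≟_; ≤-trans; m≤m⊔n; m≤n⊔m; m≤m+n; <⇒≱; +-cancelˡ-≡; +-commutativeSemigroup)
open import Algebra.Properties.CommutativeSemigroup +-commutativeSemigroup using (x∙yz≈y∙xz)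
open import Data.Empty using (⊥-elim)
open import Data.List.Relation.Binary.Disjoint.DecPropositional _≟_ using (Disjoint; disjoint?)
open import Data.List using (List; []; _∷_; _++_; _∷ʳ_; length; map; initLast; _∷ʳ′_)
open import Data.List.Membership.Propositional using (_∈_; _∉_)
open import Data.List.Membership.Propositional.Properties using (∈-map⁺; ∈-map⁻; ∈-++⁺ˡ; ∈-++⁺ʳ; ∈-++⁻)
import Data.List.Membership.DecPropositional as DecMembership
open import Data.List.Properties using (length-++; length-map; map-++; ∷ʳ-++)
open import Data.List.Relation.Unary.All using (All; all?)
import Data.List.Relation.Unary.All as All
open import Data.List.Relation.Unary.Any using (here; there)
import Data.List.Relation.Unary.Any as Any
open import Data.List.Relation.Unary.Linked using (Linked; _∷_; linked?)
import Data.List.Relation.Unary.Linked as Linked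
import Data.List.Relation.Unary.Linked.Properties as Linked
open import Data.List.Relation.Unary.Unique.Propositional using (Unique; _∷_)
import Data.List.Relation.Unary.Unique.Propositional.Properties as Unique
open import Data.List.Relation.Unary.Unique.DecPropositional using (unique?)
open import Data.Product using (_×_; _,_; ∃₂; proj₁; proj₂; swap)
open import Data.Product.Properties using (≡-dec)
open import Data.Sum using (_⊎_; inj₁; inj₂; [_,_]′)
open import Data.Unit using (⊤; tt)
open import Defs
open import Function using (_∘_)
open import Function.Definitions using (Injective)
open import Level using (0ℓ)
open import Relation.Binary.Definitions using (DecidableEquality)
open import Relation.Binary.PropositionalEquality
  using (_≡_; _≢_; refl; sym; trans; cong; cong₂; subst; module ≡-Reasoning)
open import Relation.Nullary using (¬_; Dec; yes; no; ¬?)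
open import Relation.Nullary.Decidable using (True; False; toWitness; toWitnessFalse; _×-dec_; _⊎-dec_)
open import Relation.Unary using (Pred; Decidable)

_≟ᶜ_ : DecidableEquality Colour
red  ≟ᶜ red  = yes refl
red  ≟ᶜ blue = no λ ()
blue ≟ᶜ red  = no λ ()
blue ≟ᶜ blue = yes refl

open DecMembership (≡-dec _≟_ (≡-dec _≟_ _≟ᶜ_)) using (_∈?_)

colEdge? : ∀ G c u v → Dec (ColEdge G c u v)
colEdge? G c u v = ((u , v , c) ∈? G) ⊎-dec ((v , u , c) ∈? G)

adjacent? : ∀ G u v → Dec (Adjacent G u v)
adjacent? G u v = Any.any? (λ { (a , b , _) → ((a ≟ u) ×-dec (b ≟ v)) ⊎-dec ((a ≟ v) ×-dec (b ≟ u)) }) G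

IsPath : ColouredGraph → Colour → ℕ → List ℕ → Set
IsPath G c n vs = length vs ≡ n × Unique vs × Linked (ColEdge G c) vs

isPath? : ∀ G c n vs → Dec (IsPath G c n vs)
isPath? G c n vs = (length vs ≟ n) ×-dec (unique? _≟_ vs ×-dec linked? (colEdge? G c) vs)

maxVertex : ColouredGraph → ℕ
maxVertex []                = 0
maxVertex ((a , b , _) ∷ G) = a ⊔ (b ⊔ maxVertex G)

endpoints≤maxVertex : ∀ a b c G → a ≤ maxVertex ((a , b , c) ∷ G) × b ≤ maxVertex ((a , b , c) ∷ G)
endpoints≤maxVertex a b _ G = m≤m⊔n a _ , ≤-trans (m≤m⊔n b (maxVertex G)) (m≤n⊔m a _)

maxVertex-∷ : ∀ e G → maxVertex G ≤ maxVertex (e ∷ G)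
maxVertex-∷ (a , b , _) G = ≤-trans (m≤n⊔m b (maxVertex G)) (m≤n⊔m a _)

adjacent⇒≤maxVertex : ∀ G {u v} → Adjacent G u v → u ≤ maxVertex G × v ≤ maxVertex G
adjacent⇒≤maxVertex ((a , b , c) ∷ G) (here (inj₁ (refl , refl))) = endpoints≤maxVertex a b c G
adjacent⇒≤maxVertex ((a , b , c) ∷ G) (here (inj₂ (refl , refl))) = swap (endpoints≤maxVertex a b c G)
adjacent⇒≤maxVertex (e ∷ G) (there adj) =
  let u≤ , v≤ = adjacent⇒≤maxVertex G adj in ≤-trans u≤ (maxVertex-∷ e G) , ≤-trans v≤ (maxVertex-∷ e G)

colEdge⇒adjacent : ∀ {G c u v} → ColEdge G c u v → Adjacent G u v
colEdge⇒adjacent (inj₁ uv∈) = Any.map (λ { refl → inj₁ (refl , refl) }) uv∈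
colEdge⇒adjacent (inj₂ vu∈) = Any.map (λ { refl → inj₂ (refl , refl) }) vu∈

colEdge⇒≤maxVertex : ∀ {G c u v} → ColEdge G c u v → u ≤ maxVertex G × v ≤ maxVertex G
colEdge⇒≤maxVertex {G} = adjacent⇒≤maxVertex G ∘ colEdge⇒adjacent

path-vertex≤maxVertex : ∀ {G c u v} vs {w} →
                        Linked (ColEdge G c) (u ∷ vs ∷ʳ v) → w ∈ u ∷ vs ∷ʳ v → w ≤ maxVertex G
path-vertex≤maxVertex []       (uv ∷ _)  (here refl)         = proj₁ (colEdge⇒≤maxVertex uv)
path-vertex≤maxVertex []       (uv ∷ _)  (there (here refl)) = proj₂ (colEdge⇒≤maxVertex uv)
path-vertex≤maxVertex (_ ∷ _)  (uv ∷ _)  (here refl)         = proj₁ (colEdge⇒≤maxVertex uv)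
path-vertex≤maxVertex (_ ∷ vs) (_ ∷ lk)  (there w∈)          = path-vertex≤maxVertex vs lk w∈

relabelEdge : (ℕ → ℕ) → ℕ × ℕ × Colour → ℕ × ℕ × Colour
relabelEdge φ (a , b , c) = φ a , φ b , c

relabel : (ℕ → ℕ) → ColouredGraph → ColouredGraph
relabel φ = map (relabelEdge φ)

colEdge-++⁺ʳ : ∀ {G c u v} L → ColEdge G c u v → ColEdge (L ++ G) c u v
colEdge-++⁺ʳ L (inj₁ uv∈) = inj₁ (∈-++⁺ʳ L uv∈)
colEdge-++⁺ʳ L (inj₂ vu∈) = inj₂ (∈-++⁺ʳ L vu∈)

module _ {φ : ℕ → ℕ} (G : ColouredGraph) where

  colEdge-relabel⁺ : ∀ {L c a b} → ColEdge L c a b → ColEdge (relabel φ L ++ G) c (φ a) (φ b)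
  colEdge-relabel⁺ (inj₁ ab∈) = inj₁ (∈-++⁺ˡ (∈-map⁺ (relabelEdge φ) ab∈))
  colEdge-relabel⁺ (inj₂ ba∈) = inj₂ (∈-++⁺ˡ (∈-map⁺ (relabelEdge φ) ba∈))

  hasPath-relabel⁺ : Injective _≡_ _≡_ φ → ∀ {L c n} → HasPath L c n → HasPath (relabel φ L ++ G) c n
  hasPath-relabel⁺ φ-inj (vs , len , uniq , lk) =
    map φ vs , trans (length-map φ vs) len , Unique.map⁺ φ-inj uniq , Linked.map⁺ (Linked.map colEdge-relabel⁺ lk)

  adjacent-relabel⁻ : Injective _≡_ _≡_ φ → ∀ L {a b} →
                      Adjacent (relabel φ L ++ G) (φ a) (φ b) → Adjacent L a b ⊎ Adjacent G (φ a) (φ b)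
  adjacent-relabel⁻ φ-inj []      adj                       = inj₂ adj
  adjacent-relabel⁻ φ-inj (_ ∷ L) (here (inj₁ (eqa , eqb))) = inj₁ (here (inj₁ (φ-inj eqa , φ-inj eqb)))
  adjacent-relabel⁻ φ-inj (_ ∷ L) (here (inj₂ (eqb , eqa))) = inj₁ (here (inj₂ (φ-inj eqb , φ-inj eqa)))
  adjacent-relabel⁻ φ-inj (_ ∷ L) (there adj) with adjacent-relabel⁻ φ-inj L adj
  ... | inj₁ adjL = inj₁ (there adjL)
  ... | inj₂ adjG = inj₂ adjG

Linked-join : ∀ {A : Set} {R : A → A → Set} xs {a ys} →
              Linked R (xs ∷ʳ a) → Linked R (a ∷ ys) → Linked R (xs ++ a ∷ ys)
Linked-join []           _          rest = rest
Linked-join (_ ∷ [])     (r ∷ _)    rest = r ∷ rest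
Linked-join (_ ∷ y ∷ xs) (r ∷ init) rest = r ∷ Linked-join (y ∷ xs) init rest

Disjoint-map⁺ : ∀ {f : ℕ → ℕ} → Injective _≡_ _≡_ f →
                ∀ {xs ys} → Disjoint xs ys → Disjoint (map f xs) (map f ys)
Disjoint-map⁺ {f} f-inj disj (v∈fxs , v∈fys) with ∈-map⁻ f v∈fxs | ∈-map⁻ f v∈fys
... | a , a∈ , refl | b , b∈ , fa≡fb = disj (a∈ , subst (_∈ _) (sym (f-inj fa≡fb)) b∈)

BlueOrRedP₄ : ℕ → ColouredGraph → Set
BlueOrRedP₄ n H = HasPath H blue n ⊎ HasPath H red 4

module LocalGame (Fresh : Pred ℕ 0ℓ) (BlueWon : ColouredGraph → Set) where

  Won : ColouredGraph → Set
  Won L = HasPath L red 4 ⊎ BlueWon L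

  data Strategy : ℕ → ColouredGraph → Set where
    won  : ∀ {r L} → Won L → Strategy r L
    play : ∀ {r L} a b → a ≢ b → ¬ Adjacent L a b → Fresh a ⊎ Fresh b →
           ((c : Colour) → Strategy r ((a , b , c) ∷ L)) → Strategy (suc r) L

  module _ (G : ColouredGraph) {φ : ℕ → ℕ} (φ-inj : Injective _≡_ _≡_ φ)
           (fresh⇒new : ∀ {a} → Fresh a → maxVertex G < φ a)
           {n : ℕ} (blueWon⇒path : ∀ {L} → BlueWon L → HasPath (relabel φ L ++ G) blue n) where

    fresh⇒¬adjacent : ∀ {a b} → Fresh a ⊎ Fresh b → ¬ Adjacent G (φ a) (φ b)
    fresh⇒¬adjacent (inj₁ fa) adj = <⇒≱ (fresh⇒new fa) (proj₁ (adjacent⇒≤maxVertex G adj))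
    fresh⇒¬adjacent (inj₂ fb) adj = <⇒≱ (fresh⇒new fb) (proj₂ (adjacent⇒≤maxVertex G adj))

    realise : ∀ {r L} → Strategy r L → BuilderForces (BlueOrRedP₄ n) r (relabel φ L ++ G)
    realise (won (inj₁ redPath)) = done (inj₂ (hasPath-relabel⁺ G φ-inj redPath))
    realise (won (inj₂ blueWon))  = done (inj₁ (blueWon⇒path blueWon))
    realise {L = L} (play a b a≢b ¬adj fresh next) =
      move (φ a) (φ b) (a≢b ∘ φ-inj) new λ c → realise (next c)
      where
      new : ¬ Adjacent (relabel φ L ++ G) (φ a) (φ b)
      new adj with adjacent-relabel⁻ G φ-inj L adj
      ... | inj₁ adjL = ¬adj adjL
      ... | inj₂ adjG = fresh⇒¬adjacent fresh adjG

  module Moves (Fresh? : Decidable Fresh) where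

    draw : ∀ {r L} a b {_ : True (¬? (a ≟ b))} {_ : False (adjacent? L a b)}
           {_ : True (Fresh? a ⊎-dec Fresh? b)} →
           Strategy r ((a , b , red) ∷ L) → Strategy r ((a , b , blue) ∷ L) → Strategy (suc r) L
    draw a b {a≢b} {¬adj} {fresh} ifRed ifBlue =
      play a b (toWitness a≢b) (toWitnessFalse ¬adj) (toWitness fresh) λ { red → ifRed ; blue → ifBlue }

    redP₄ : ∀ {r L} vs {_ : True (isPath? L red 4 vs)} → Strategy r L
    redP₄ vs {p} = won (inj₁ (vs , toWitness p))

module BlueP₅FromScratch where
  open LocalGame (λ _ → ⊤) (λ L → HasPath L blue 5) public
  open Moves (λ _ → yes tt)

  blueP₅ : ∀ {r L} vs {_ : True (isPath? L blue 5 vs)} → Strategy r L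
  blueP₅ vs {p} = won (inj₂ (vs , toWitness p))

  strategy : Strategy 6 []
  strategy =
    draw 0 1
      (draw 0 2
         (draw 1 3
            (redP₄ (3 ∷ 1 ∷ 0 ∷ 2 ∷ []))
            (draw 1 4
               (redP₄ (4 ∷ 1 ∷ 0 ∷ 2 ∷ []))
               (draw 2 3
                  (redP₄ (1 ∷ 0 ∷ 2 ∷ 3 ∷ []))
                  (draw 2 5
                     (redP₄ (1 ∷ 0 ∷ 2 ∷ 5 ∷ []))
                     (blueP₅ (4 ∷ 1 ∷ 3 ∷ 2 ∷ 5 ∷ []))))))
         (draw 0 3
            (draw 1 2
               (redP₄ (3 ∷ 0 ∷ 1 ∷ 2 ∷ []))
               (draw 1 4
                  (redP₄ (3 ∷ 0 ∷ 1 ∷ 4 ∷ []))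
                  (draw 3 4
                     (redP₄ (1 ∷ 0 ∷ 3 ∷ 4 ∷ []))
                     (blueP₅ (3 ∷ 4 ∷ 1 ∷ 2 ∷ 0 ∷ [])))))
            (draw 1 4
               (draw 2 4
                  (redP₄ (0 ∷ 1 ∷ 4 ∷ 2 ∷ []))
                  (draw 4 5
                     (redP₄ (0 ∷ 1 ∷ 4 ∷ 5 ∷ []))
                     (blueP₅ (3 ∷ 0 ∷ 2 ∷ 4 ∷ 5 ∷ []))))
               (draw 1 2
                  (draw 2 4
                     (redP₄ (0 ∷ 1 ∷ 2 ∷ 4 ∷ []))
                     (blueP₅ (3 ∷ 0 ∷ 2 ∷ 4 ∷ 1 ∷ [])))
                  (blueP₅ (3 ∷ 0 ∷ 2 ∷ 1 ∷ 4 ∷ []))))))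
      (draw 0 2
         (draw 0 3
            (draw 1 2
               (redP₄ (1 ∷ 2 ∷ 0 ∷ 3 ∷ []))
               (draw 2 4
                  (redP₄ (4 ∷ 2 ∷ 0 ∷ 3 ∷ []))
                  (draw 3 4
                     (redP₄ (4 ∷ 3 ∷ 0 ∷ 2 ∷ []))
                     (blueP₅ (3 ∷ 4 ∷ 2 ∷ 1 ∷ 0 ∷ [])))))
            (draw 1 4
               (draw 1 2
                  (redP₄ (4 ∷ 1 ∷ 2 ∷ 0 ∷ []))
                  (draw 2 4
                     (redP₄ (1 ∷ 4 ∷ 2 ∷ 0 ∷ []))
                     (blueP₅ (3 ∷ 0 ∷ 1 ∷ 2 ∷ 4 ∷ []))))
               (draw 2 3
                  (draw 3 5
                     (redP₄ (5 ∷ 3 ∷ 2 ∷ 0 ∷ []))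
                     (blueP₅ (4 ∷ 1 ∷ 0 ∷ 3 ∷ 5 ∷ [])))
                  (blueP₅ (2 ∷ 3 ∷ 0 ∷ 1 ∷ 4 ∷ [])))))
         (draw 1 3
            (draw 1 4
               (draw 2 3
                  (redP₄ (2 ∷ 3 ∷ 1 ∷ 4 ∷ []))
                  (draw 3 5
                     (redP₄ (5 ∷ 3 ∷ 1 ∷ 4 ∷ []))
                     (blueP₅ (5 ∷ 3 ∷ 2 ∷ 0 ∷ 1 ∷ []))))
               (draw 2 3
                  (draw 2 5
                     (redP₄ (1 ∷ 3 ∷ 2 ∷ 5 ∷ []))
                     (blueP₅ (4 ∷ 1 ∷ 0 ∷ 2 ∷ 5 ∷ [])))
                  (blueP₅ (3 ∷ 2 ∷ 0 ∷ 1 ∷ 4 ∷ []))))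
            (draw 2 4
               (draw 2 5
                  (draw 3 4
                     (redP₄ (3 ∷ 4 ∷ 2 ∷ 5 ∷ []))
                     (blueP₅ (4 ∷ 3 ∷ 1 ∷ 0 ∷ 2 ∷ [])))
                  (blueP₅ (5 ∷ 2 ∷ 0 ∷ 1 ∷ 3 ∷ [])))
               (blueP₅ (4 ∷ 2 ∷ 0 ∷ 1 ∷ 3 ∷ [])))))

-- Local vertices 0 and 1 stand for the ends x and y of the blue path (see ExtendBothEnds.anchor).
Extension : ColouredGraph → List ℕ → List ℕ → Set
Extension L P Q =
  Unique P × Unique Q × Disjoint P Q × All (2 ≤_) P × All (2 ≤_) Q × length P + length Q ≡ 4 ×
  Linked (ColEdge L blue) (P ∷ʳ 0) × Linked (ColEdge L blue) (1 ∷ Q)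

extension? : ∀ L P Q → Dec (Extension L P Q)
extension? L P Q =
  unique? _≟_ P ×-dec unique? _≟_ Q ×-dec disjoint? P Q ×-dec all? (2 ≤?_) P ×-dec all? (2 ≤?_) Q ×-dec
  (length P + length Q ≟ 4) ×-dec linked? (colEdge? L blue) (P ∷ʳ 0) ×-dec linked? (colEdge? L blue) (1 ∷ Q)

module ExtensionStrategy where
  open LocalGame (2 ≤_) (λ L → ∃₂ (Extension L)) public
  open Moves (2 ≤?_)

  extension : ∀ {r L} P Q {_ : True (extension? L P Q)} → Strategy r L
  extension P Q {e} = won (inj₂ (P , Q , toWitness e))

  strategy : Strategy 6 []
  strategy =
    draw 2 3
      (draw 2 4
         (draw 0 3
            (redP₄ (4 ∷ 2 ∷ 3 ∷ 0 ∷ []))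
            (draw 1 4
               (redP₄ (3 ∷ 2 ∷ 4 ∷ 1 ∷ []))
               (draw 3 5
                  (redP₄ (5 ∷ 3 ∷ 2 ∷ 4 ∷ []))
                  (draw 4 6
                     (redP₄ (3 ∷ 2 ∷ 4 ∷ 6 ∷ []))
                     (extension (5 ∷ 3 ∷ []) (4 ∷ 6 ∷ []))))))
         (draw 0 2
            (draw 0 4
               (redP₄ (3 ∷ 2 ∷ 0 ∷ 4 ∷ []))
               (draw 1 3
                  (redP₄ (0 ∷ 2 ∷ 3 ∷ 1 ∷ []))
                  (draw 3 5
                     (redP₄ (0 ∷ 2 ∷ 3 ∷ 5 ∷ []))
                     (extension (2 ∷ 4 ∷ []) (3 ∷ 5 ∷ [])))))
            (draw 1 5
               (draw 1 3
                  (redP₄ (2 ∷ 3 ∷ 1 ∷ 5 ∷ []))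
                  (draw 3 5
                     (redP₄ (2 ∷ 3 ∷ 5 ∷ 1 ∷ []))
                     (extension (4 ∷ 2 ∷ []) (3 ∷ 5 ∷ []))))
               (draw 3 4
                  (draw 4 6
                     (redP₄ (2 ∷ 3 ∷ 4 ∷ 6 ∷ []))
                     (extension (6 ∷ 4 ∷ 2 ∷ []) (5 ∷ [])))
                  (extension (3 ∷ 4 ∷ 2 ∷ []) (5 ∷ []))))))
      (draw 0 4
         (draw 0 2
            (draw 1 2
               (redP₄ (4 ∷ 0 ∷ 2 ∷ 1 ∷ []))
               (draw 3 4
                  (redP₄ (2 ∷ 0 ∷ 4 ∷ 3 ∷ []))
                  (draw 4 5
                     (redP₄ (2 ∷ 0 ∷ 4 ∷ 5 ∷ []))
                     (extension [] (2 ∷ 3 ∷ 4 ∷ 5 ∷ [])))))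
            (draw 1 5
               (draw 1 4
                  (redP₄ (5 ∷ 1 ∷ 4 ∷ 0 ∷ []))
                  (draw 4 5
                     (redP₄ (1 ∷ 5 ∷ 4 ∷ 0 ∷ []))
                     (extension (3 ∷ 2 ∷ []) (4 ∷ 5 ∷ []))))
               (draw 3 4
                  (draw 3 6
                     (redP₄ (6 ∷ 3 ∷ 4 ∷ 0 ∷ []))
                     (extension (6 ∷ 3 ∷ 2 ∷ []) (5 ∷ [])))
                  (extension (4 ∷ 3 ∷ 2 ∷ []) (5 ∷ [])))))
         (draw 1 2
            (draw 1 3
               (draw 2 4
                  (redP₄ (4 ∷ 2 ∷ 1 ∷ 3 ∷ []))
                  (draw 3 5
                     (redP₄ (5 ∷ 3 ∷ 1 ∷ 2 ∷ []))
                     (extension (5 ∷ 3 ∷ 2 ∷ 4 ∷ []) ([]))))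
               (draw 2 5
                  (draw 4 5
                     (redP₄ (4 ∷ 5 ∷ 2 ∷ 1 ∷ []))
                     (extension (5 ∷ 4 ∷ []) (3 ∷ 2 ∷ [])))
                  (extension (4 ∷ []) (3 ∷ 2 ∷ 5 ∷ []))))
            (draw 3 5
               (draw 3 6
                  (draw 4 5
                     (redP₄ (6 ∷ 3 ∷ 5 ∷ 4 ∷ []))
                     (extension (5 ∷ 4 ∷ []) (2 ∷ 3 ∷ [])))
                  (extension (4 ∷ []) (2 ∷ 3 ∷ 6 ∷ [])))
               (extension (4 ∷ []) (2 ∷ 3 ∷ 5 ∷ [])))))

module ExtendBothEnds (G : ColouredGraph) {k x y : ℕ} {mid : List ℕ} (path : IsPath G blue k (x ∷ mid ∷ʳ y)) where

  core : List ℕ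
  core = x ∷ mid ∷ʳ y

  x∈core : x ∈ core
  x∈core = here refl

  y∈core : y ∈ core
  y∈core = there (∈-++⁺ʳ mid (here refl))

  x≢y : x ≢ y
  x≢y with proj₁ (proj₂ path)
  ... | x≢rest ∷ _ = All.lookup x≢rest (∈-++⁺ʳ mid (here refl))

  bound : ℕ
  bound = suc (maxVertex G)

  anchor : ℕ → ℕ
  anchor 0             = x
  anchor 1             = y
  anchor (suc (suc i)) = bound + i

  fresh⇒bound≤anchor : ∀ {a} → 2 ≤ a → bound ≤ anchor a
  fresh⇒bound≤anchor {suc (suc i)} _        = m≤m+n bound i
  fresh⇒bound≤anchor {1}           (s≤s ())

  core≢fresh : ∀ {w a} → w ∈ core → 2 ≤ a → w ≢ anchor a
  core≢fresh w∈ 2≤a refl =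
    <⇒≱ (s≤s (path-vertex≤maxVertex mid (proj₂ (proj₂ path)) w∈)) (fresh⇒bound≤anchor 2≤a)

  anchor-injective : Injective _≡_ _≡_ anchor
  anchor-injective {0}           {0}           _  = refl
  anchor-injective {1}           {1}           _  = refl
  anchor-injective {0}           {1}           eq = ⊥-elim (x≢y eq)
  anchor-injective {1}           {0}           eq = ⊥-elim (x≢y (sym eq))
  anchor-injective {0}           {suc (suc j)} eq = ⊥-elim (core≢fresh x∈core (m≤m+n 2 j) eq)
  anchor-injective {1}           {suc (suc j)} eq = ⊥-elim (core≢fresh y∈core (m≤m+n 2 j) eq)
  anchor-injective {suc (suc i)} {0}           eq = ⊥-elim (core≢fresh x∈core (m≤m+n 2 i) (sym eq))
  anchor-injective {suc (suc i)} {1}           eq = ⊥-elim (core≢fresh y∈core (m≤m+n 2 i) (sym eq))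
  anchor-injective {suc (suc i)} {suc (suc j)} eq = cong (suc ∘ suc) (+-cancelˡ-≡ bound i j eq)

  module _ {L : ColouredGraph} where

    private
      H = relabel anchor L ++ G

    fresh-images-avoid-core : ∀ {P w} → All (2 ≤_) P → w ∈ core → w ∉ map anchor P
    fresh-images-avoid-core fresh w∈ w∈P with ∈-map⁻ anchor w∈P
    ... | a , a∈ , refl = core≢fresh w∈ (All.lookup fresh a∈) refl

    extension⇒path : ∀ {P Q} → Extension L P Q → HasPath H blue (k + 4)
    extension⇒path {P} {Q} (uniqP , uniqQ , disjPQ , freshP , freshQ , size , linkP , linkQ) =
      map anchor P ++ core ++ map anchor Q , lengthW , uniqueW , linkedW
      where
      open ≡-Reasoning

      lengthW : length (map anchor P ++ core ++ map anchor Q) ≡ k + 4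
      lengthW = begin
        length (map anchor P ++ core ++ map anchor Q)     ≡⟨ length-++ (map anchor P) ⟩
        length (map anchor P) + length (core ++ map anchor Q)
          ≡⟨ cong₂ _+_ (length-map anchor P) (length-++ core) ⟩
        length P + (length core + length (map anchor Q))
          ≡⟨ cong₂ (λ m n → length P + (m + n)) (proj₁ path) (length-map anchor Q) ⟩
        length P + (k + length Q)                         ≡⟨ x∙yz≈y∙xz (length P) k (length Q) ⟩
        k + (length P + length Q)                         ≡⟨ cong (k +_) size ⟩
        k + 4                                             ∎

      uniqueW : Unique (map anchor P ++ core ++ map anchor Q)
      uniqueW = Unique.++⁺ (Unique.map⁺ anchor-injective uniqP) uniqueRest disjoint
        where
        uniqueRest : Unique (core ++ map anchor Q)
        uniqueRest = Unique.++⁺ (proj₁ (proj₂ path)) (Unique.map⁺ anchor-injective uniqQ)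
                       λ (w∈core , w∈Q) → fresh-images-avoid-core freshQ w∈core w∈Q

        disjoint : Disjoint (map anchor P) (core ++ map anchor Q)
        disjoint (w∈P , w∈rest) with ∈-++⁻ core w∈rest
        ... | inj₁ w∈core = fresh-images-avoid-core freshP w∈core w∈P
        ... | inj₂ w∈Q    = Disjoint-map⁺ anchor-injective disjPQ (w∈P , w∈Q)

      linkedW : Linked (ColEdge H blue) (map anchor P ++ core ++ map anchor Q)
      linkedW = subst (λ ws → Linked (ColEdge H blue) (map anchor P ++ ws))
                  (sym (∷ʳ-++ (x ∷ mid) y (map anchor Q)))
                  (Linked-join (map anchor P) linkP′ (Linked-join (x ∷ mid) linkCore linkQ′))
        where
        relabelled : ∀ {vs} → Linked (ColEdge L blue) vs → Linked (ColEdge H blue) (map anchor vs)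
        relabelled lk = Linked.map⁺ (Linked.map (colEdge-relabel⁺ G) lk)

        linkP′ : Linked (ColEdge H blue) (map anchor P ∷ʳ x)
        linkP′ = subst (Linked (ColEdge H blue)) (map-++ anchor P (0 ∷ [])) (relabelled linkP)

        linkQ′ : Linked (ColEdge H blue) (y ∷ map anchor Q)
        linkQ′ = relabelled linkQ

        linkCore : Linked (ColEdge H blue) core
        linkCore = Linked.map (colEdge-++⁺ʳ (relabel anchor L)) (proj₂ (proj₂ path))

  extend-or-redP₄ : BuilderForces (BlueOrRedP₄ (k + 4)) 6 G
  extend-or-redP₄ =
    ExtensionStrategy.realise G anchor-injective fresh⇒bound≤anchor (λ (_ , _ , ext) → extension⇒path ext)
      ExtensionStrategy.strategy

blueP₅-or-redP₄ : ∀ G → BuilderForces (BlueOrRedP₄ 5) 6 G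
blueP₅-or-redP₄ G =
  BlueP₅FromScratch.realise G shift-injective (λ _ → m≤m+n bound _) (hasPath-relabel⁺ G shift-injective)
    BlueP₅FromScratch.strategy
  where
  bound = suc (maxVertex G)

  shift-injective : Injective _≡_ _≡_ (bound +_)
  shift-injective = +-cancelˡ-≡ bound _ _

lemma4p1 : (k : ℕ) → 1 ≤ k → (G : ColouredGraph) → Simple G → HasPath G blue k →
    BuilderForces (λ H → HasPath H blue (k + 4) ⊎ HasPath H red 4) 6 G
lemma4p1 1             _ G _ _ = blueP₅-or-redP₄ G
lemma4p1 (suc (suc k)) _ G _ (x ∷ vs , len , uniq , link) with initLast vs
lemma4p1 (suc (suc k)) _ G _ (x ∷ _ , () , _ , _) | []
... | mid ∷ʳ′ y = ExtendBothEnds.extend-or-redP₄ G (len , uniq , link)
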